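{- Let $G$ be a finite group, $\alpha$ an involutory automorphism of $G$, and $H$ a subgroup of $G$ that is a perfect code of $GC(G,S,\alpha)$ for some generalized Cayley subset $S$ of $G$ induced by $\alpha$. If $K$ is a subgroup of $G$ with $H\le K$ and $\alpha(K)=K$, then, writing $\alpha|_K$ for the restriction of $\alpha$ to $K$, there exists a generalized Cayley subset $S'$ of $K$ induced by $\alpha|_K$ such that $H$ is a perfect code of $GC(K,S',\alpha|_K)$.
   Context: For a finite group $G$ with identity $e$ and an automorphism $\gamma$ of $G$ with $\gamma^2=\mathrm{id}$ (involutory if moreover $\gamma\neq\mathrm{id}$), set $\omega_\gamma(G)=\{\gamma(g^{ -1})g\mid g\in G\}$. A subset $S\subseteq G$ is a generalized Cayley subset of $G$ induced by $\gamma$ if $S\cap\omega_\gamma(G)=\emptyset$ and $\gamma(S)=S^{ -1}$ (where $\gamma(A)=\{\gamma(a)\mid a\in A\}$, $A^{ -1}=\{a^{ -1}\mid a\in A\}$). The generalized Cayley graph $GC(G,S,\gamma)$ has vertex set $G$ and edge set $\{\{g,h\}\mid \gamma(g^{ -1})h\in S\}$. A subset $C$ of the vertex set of a graph is a perfect code if $C$ is independent and every vertex outside $C$ is adjacent to exactly one vertex of $C$. -}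

module Defs where

open import Level using (Level; _⊔_)
open import Data.Nat using (ℕ)
open import Data.Fin using (Fin)
open import Data.Product using (Σ; ∃; _×_; _,_; proj₁; proj₂)
open import Data.Sum using (_⊎_)
open import Relation.Nullary using (¬_)
open import Relation.Unary using (Pred)
open import Algebra.Bundles using (Group)
open import Algebra.Structures using (IsGroup; IsMonoid; IsSemigroup; IsMagma)
open import Relation.Binary.Structures using (IsEquivalence)

module _ {c ℓ : Level} (G : Group c ℓ) where
  open Group G

  Finite : Set (c ⊔ ℓ)
  Finite = Σ ℕ λ n → Σ (Fin n → Carrier) λ f → ∀ x → ∃ λ i → f i ≈ x

  RespectsEq : {p : Level} → Pred Carrier p → Set (c ⊔ ℓ ⊔ p)
  RespectsEq A = ∀ {x y} → x ≈ y → A x → A y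

  record IsAutomorphism (γ : Carrier → Carrier) : Set (c ⊔ ℓ) where
    field
      cong       : ∀ {x y} → x ≈ y → γ x ≈ γ y
      homo       : ∀ x y → γ (x ∙ y) ≈ γ x ∙ γ y
      injective  : ∀ {x y} → γ x ≈ γ y → x ≈ y
      surjective : ∀ y → ∃ λ x → γ x ≈ y

  record IsInvolutoryAutomorphism (γ : Carrier → Carrier) : Set (c ⊔ ℓ) where
    field
      isAutomorphism : IsAutomorphism γ
      involution     : ∀ x → γ (γ x) ≈ x
      nonIdentity    : ¬ (∀ x → γ x ≈ x)

  record IsSubgroup {p : Level} (K : Pred Carrier p) : Set (c ⊔ ℓ ⊔ p) where
    field
      resp  : RespectsEq K
      ε∈    : K ε
      ∙-closed : ∀ {x y} → K x → K y → K (x ∙ y)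
      ⁻¹-closed : ∀ {x} → K x → K (x ⁻¹)

  image : {p : Level} → (Carrier → Carrier) → Pred Carrier p → Pred Carrier (c ⊔ ℓ ⊔ p)
  image γ A x = ∃ λ a → A a × x ≈ γ a

  inverseSet : {p : Level} → Pred Carrier p → Pred Carrier (c ⊔ ℓ ⊔ p)
  inverseSet A x = ∃ λ a → A a × x ≈ a ⁻¹

  ω : (Carrier → Carrier) → Pred Carrier (c ⊔ ℓ)
  ω γ x = ∃ λ g → x ≈ γ (g ⁻¹) ∙ g

  record IsGenCayleySubset {p : Level} (S : Pred Carrier p) (γ : Carrier → Carrier)
         : Set (c ⊔ ℓ ⊔ p) where
    field
      resp     : RespectsEq S
      disjoint : ∀ x → S x → ¬ ω γ x
      γS≡S⁻¹   : ∀ x → (image γ S x → inverseSet S x) × (inverseSet S x → image γ S x)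

  Adj : {p : Level} → Pred Carrier p → (Carrier → Carrier) → Carrier → Carrier → Set p
  Adj S γ g h = S (γ (g ⁻¹) ∙ h) ⊎ S (γ (h ⁻¹) ∙ g)

  record IsPerfectCode {p q : Level} (S : Pred Carrier p) (γ : Carrier → Carrier)
         (C : Pred Carrier q) : Set (c ⊔ ℓ ⊔ p ⊔ q) where
    field
      independent : ∀ x y → C x → C y → ¬ Adj S γ x y
      uniqueNeighbour : ∀ v → ¬ C v →
        ∃ λ x → C x × Adj S γ v x × (∀ y → C y → Adj S γ v y → y ≈ x)

  subgroup : {p : Level} (K : Pred Carrier p) → IsSubgroup K → Group (c ⊔ p) ℓ
  subgroup K sg = record
    { Carrier = Σ Carrier K
    ; _≈_ = λ a b → proj₁ a ≈ proj₁ b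
    ; _∙_ = λ a b → (proj₁ a ∙ proj₁ b , ∙-closed (proj₂ a) (proj₂ b))
    ; ε = (ε , ε∈)
    ; _⁻¹ = λ a → (proj₁ a ⁻¹ , ⁻¹-closed (proj₂ a))
    ; isGroup = record
      { isMonoid = record
        { isSemigroup = record
          { isMagma = record
            { isEquivalence = record { refl = refl ; sym = sym ; trans = trans }
            ; ∙-cong = ∙-cong }
          ; assoc = λ a b c' → assoc (proj₁ a) (proj₁ b) (proj₁ c') }
        ; identity = (λ a → identityˡ (proj₁ a)) , (λ a → identityʳ (proj₁ a)) }
      ; inverse = (λ a → inverseˡ (proj₁ a)) , (λ a → inverseʳ (proj₁ a))
      ; ⁻¹-cong = ⁻¹-cong }
    }
    where open IsSubgroup sg

  restrict : {p : Level} (K : Pred Carrier p) (sg : IsSubgroup K)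
             (γ : Carrier → Carrier) → (∀ {x} → K x → K (γ x)) →
             Group.Carrier (subgroup K sg) → Group.Carrier (subgroup K sg)
  restrict K sg γ γK (x , kx) = (γ x , γK kx)

{-# OPTIONS --safe #-}
module Submission where

open import Defs
open import Level using (Level; _⊔_)
open import Data.Product using (Σ; ∃; _×_; proj₁; proj₂; _,_)
open import Relation.Unary using (Pred)
open import Algebra.Bundles using (Group)
import Algebra.Properties.Group as GroupProperties

-- Take S′ = S ∩ K. Membership in S and in ω_γ and adjacency are all computed in G, so S′
-- inherits disjointness from ω_γ(K) ⊆ ω_γ(G), and γ(S′) = S′⁻¹ holds because K is closed
-- under inverses and under the involution γ. A perfect code contained in K already gives
-- every vertex of K exactly one neighbour in the code, so it remains a perfect code of the
-- induced graph on K.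

module _ {c ℓ p : Level} (G : Group c ℓ)
         {K : Pred (Group.Carrier G) p} (sgK : IsSubgroup G K) where
  open Group G
  open IsSubgroup sgK
  open GroupProperties G using (⁻¹-involutive)

  K̂ : Group (c ⊔ p) ℓ
  K̂ = subgroup G K sgK

  onSubgroup : {q : Level} → Pred Carrier q → Pred (Group.Carrier K̂) q
  onSubgroup A k = A (proj₁ k)

  ≈⁻¹-reflects-∈ : ∀ {x b} → K x → x ≈ b ⁻¹ → K b
  ≈⁻¹-reflects-∈ {b = b} kx x≈b⁻¹ =
    resp (trans (⁻¹-cong x≈b⁻¹) (⁻¹-involutive b)) (⁻¹-closed kx)

  module _ {γ : Carrier → Carrier} (γK⊆K : ∀ {x} → K x → K (γ x)) where

    γ∣K : Group.Carrier K̂ → Group.Carrier K̂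
    γ∣K = restrict G K sgK γ γK⊆K

    ≈image-reflects-∈ : (∀ {x y} → x ≈ y → γ x ≈ γ y) → (∀ x → γ (γ x) ≈ x) →
                        ∀ {x a} → K x → x ≈ γ a → K a
    ≈image-reflects-∈ γ-cong γ-involutive {a = a} kx x≈γa =
      resp (trans (γ-cong x≈γa) (γ-involutive a)) (γK⊆K kx)

    genCayleySubset-onSubgroup :
      (∀ {x y} → x ≈ y → γ x ≈ γ y) → (∀ x → γ (γ x) ≈ x) →
      {q : Level} {S : Pred Carrier q} → IsGenCayleySubset G S γ →
      IsGenCayleySubset K̂ (onSubgroup S) γ∣K
    genCayleySubset-onSubgroup γ-cong γ-involutive {S = S} gcS = record
      { resp     = GC.resp
      ; disjoint = λ { (x , _) sx ((g , _) , x≈γg⁻¹g) → GC.disjoint x sx (g , x≈γg⁻¹g) }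
      ; γS≡S⁻¹   = λ { (x , kx) → image⇒inverseSet kx , inverseSet⇒image kx }
      }
      where
      module GC = IsGenCayleySubset gcS

      image⇒inverseSet : ∀ {x} (kx : K x) →
        image K̂ γ∣K (onSubgroup S) (x , kx) →
        inverseSet K̂ (onSubgroup S) (x , kx)
      image⇒inverseSet {x} kx ((a , _) , sa , x≈γa)
        with proj₁ (GC.γS≡S⁻¹ x) (a , sa , x≈γa)
      ... | b , sb , x≈b⁻¹ = (b , ≈⁻¹-reflects-∈ kx x≈b⁻¹) , sb , x≈b⁻¹

      inverseSet⇒image : ∀ {x} (kx : K x) →
        inverseSet K̂ (onSubgroup S) (x , kx) →
        image K̂ γ∣K (onSubgroup S) (x , kx)
      inverseSet⇒image {x} kx ((b , _) , sb , x≈b⁻¹)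
        with proj₂ (GC.γS≡S⁻¹ x) (b , sb , x≈b⁻¹)
      ... | a , sa , x≈γa = (a , ≈image-reflects-∈ γ-cong γ-involutive kx x≈γa) , sa , x≈γa

    perfectCode-onSubgroup :
      {q r : Level} {S : Pred Carrier q} {C : Pred Carrier r} → (∀ {x} → C x → K x) →
      IsPerfectCode G S γ C →
      IsPerfectCode K̂ (onSubgroup S) γ∣K (onSubgroup C)
    IsPerfectCode.independent (perfectCode-onSubgroup _ pcC) x y =
      IsPerfectCode.independent pcC (proj₁ x) (proj₁ y)
    IsPerfectCode.uniqueNeighbour (perfectCode-onSubgroup C⊆K pcC) (v , _) v∉C
      with IsPerfectCode.uniqueNeighbour pcC v v∉C
    ... | x , cx , v~x , unique = (x , C⊆K cx) , cx , v~x , λ y cy → unique (proj₁ y) cy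

proposition2p21 : {c ℓ p : Level} (G : Group c ℓ) → Finite G →
    (α : Group.Carrier G → Group.Carrier G) → IsInvolutoryAutomorphism G α →
    (H : Pred (Group.Carrier G) p) → IsSubgroup G H →
    (S : Pred (Group.Carrier G) p) → IsGenCayleySubset G S α →
    IsPerfectCode G S α H →
    (K : Pred (Group.Carrier G) p) → (sgK : IsSubgroup G K) →
    (H⊆K : ∀ x → H x → K x) →
    (αK⊆K : ∀ {x} → K x → K (α x)) →
    (K⊆αK : ∀ x → K x → ∃ λ y → K y × Group._≈_ G (α y) x) →
    Σ (Pred (Group.Carrier (subgroup G K sgK)) p) λ S′ →
    IsGenCayleySubset (subgroup G K sgK) S′ (restrict G K sgK α αK⊆K) ×
    IsPerfectCode (subgroup G K sgK) S′ (restrict G K sgK α αK⊆K) (λ k → H (proj₁ k))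
proposition2p21 G _ α inv H _ S gcS pcS K sgK H⊆K αK⊆K _ =
  onSubgroup G sgK S ,
  genCayleySubset-onSubgroup G sgK αK⊆K AA.cong involution gcS ,
  perfectCode-onSubgroup G sgK αK⊆K (H⊆K _) pcS
  where
  open IsInvolutoryAutomorphism inv
  module AA = IsAutomorphism isAutomorphism
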